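{- Let $G$ be the directed graph and $\mathcal{P}$ the path family described in the context. Any new positive weight function $w_H$ on the edges of $G$ for which all paths in $\mathcal{P}$ remain shortest paths has aspect ratio $2^{\Omega(n)}$.
   Context: Let $n$ be divisible by $3$ and $m=n/3$. The directed graph $G$ has vertices $v_i^1,v_i^2,v_i^3$ for $i=1,\dots,m$, forming cycles $C_i$. If $i$ is odd, $C_i$ consists of edges $(v_i^1,v_i^2),(v_i^2,v_i^3),(v_i^3,v_i^1)$; if $i$ is even, $C_i$ consists of edges $(v_i^1,v_i^3),(v_i^3,v_i^2),(v_i^2,v_i^1)$. For every $i<m$ and $k\in\{1,2,3\}$ there is a cross-cycle edge $(v_i^k,v_{i+1}^k)$. The family $\mathcal{P}$: for each $i<m$ and each edge $(v_i^k,v_i^{k'})$ of $C_i$, $\mathcal{P}$ contains the path from $v_i^k$ to $v_{i+1}^{k'}$ that takes the edge $(v_i^k,v_{i+1}^k)$ and then follows $C_{i+1}$ from $v_{i+1}^k$ to $v_{i+1}^{k'}$ (two edges of $C_{i+1}$). The aspect ratio of $w_H$ is $\max_e w_H(e)/\min_e w_H(e)$; $2^{\Omega(n)}$ means at least $2^{cn}$ for an absolute constant $c>0$ and all sufficiently large $n$.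
   Formalization: The new positive weight function $w_H$ takes only rational values on the edges of $G$. -}

module Defs where

import Data.Nat
import Data.Rational
open import Data.Nat using (ℕ; zero; suc; _≤_)
open import Data.Bool using (Bool; true; false; not)
open import Data.Fin using (Fin; zero; suc)
open import Data.Product using (_×_; _,_; Σ; ∃; ∃-syntax)
open import Data.Rational using (ℚ; 0ℚ; 1ℚ; _+_; _*_) renaming (_≤_ to _≤ℚ_; _<_ to _<ℚ_)

-- Cycle indices i are 1-based (i = 1, …, m) as in the paper; the vertex v_i^k
-- is represented by (i , k) with k : Fin 3 (zero ↦ 1, suc zero ↦ 2, suc (suc zero) ↦ 3).
Vertex : Set
Vertex = ℕ × Fin 3

isOdd : ℕ → Bool
isOdd zero    = false
isOdd (suc n) = not (isOdd n)

next : Fin 3 → Fin 3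
next zero             = suc zero
next (suc zero)       = suc (suc zero)
next (suc (suc zero)) = zero

prev : Fin 3 → Fin 3
prev zero             = suc (suc zero)
prev (suc zero)       = zero
prev (suc (suc zero)) = suc zero

-- successor of v_i^k along the directed cycle C_i
-- (odd i: v^1→v^2→v^3→v^1 ; even i: v^1→v^3→v^2→v^1)
step : ℕ → Fin 3 → Fin 3
step i k with isOdd i
... | true  = next k
... | false = prev k

-- Edges of the directed graph G (with m cycles, n = 3m vertices)
data Edge (m : ℕ) : Vertex → Vertex → Set where
  cyc   : (i : ℕ) (k : Fin 3) → 1 ≤ i → i ≤ m → Edge m (i , k) (i , step i k)
  cross : (i : ℕ) (k : Fin 3) → 1 ≤ i → suc i ≤ m → Edge m (i , k) (suc i , k)

Weight : ℕ → Set
Weight m = ∀ {u v} → Edge m u v → ℚ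

Positive : ∀ {m} → Weight m → Set
Positive {m} w = ∀ {u v} (e : Edge m u v) → 0ℚ <ℚ w e

data Walk (m : ℕ) : Vertex → Vertex → Set where
  []  : ∀ {u} → Walk m u u
  _∷_ : ∀ {u v x} → Edge m u v → Walk m v x → Walk m u x

len : ∀ {m} → Weight m → ∀ {u v} → Walk m u v → ℚ
len w []       = 0ℚ
len w (e ∷ p)  = w e + len w p

IsShortest : ∀ {m} → Weight m → ∀ {u v} → Walk m u v → Set
IsShortest {m} w {u} {v} p = (q : Walk m u v) → len w p ≤ℚ len w q

-- The path of 𝒫 associated with the edge (v_i^k , v_i^{k'}) of C_i (k' = step i k),
-- 1 ≤ i < m: take (v_i^k , v_{i+1}^k), then follow C_{i+1} for two edges from v_{i+1}^k
-- (which ends at v_{i+1}^{k'}).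
pathP : (m i : ℕ) (k : Fin 3) → (1i : 1 ≤ i) → (im : suc i ≤ m) →
        Walk m (i , k) (suc i , step (suc i) (step (suc i) k))
pathP m i k 1i im =
  cross i k 1i im ∷
  (cyc (suc i) k (Data.Nat.s≤s Data.Nat.z≤n) im ∷
  (cyc (suc i) (step (suc i) k) (Data.Nat.s≤s Data.Nat.z≤n) im ∷ []))

AllPShortest : ∀ {m} → Weight m → Set
AllPShortest {m} w =
  (i : ℕ) (k : Fin 3) (1i : 1 ≤ i) (im : suc i ≤ m) → IsShortest w (pathP m i k 1i im)

_^ℚ_ : ℚ → ℕ → ℚ
x ^ℚ zero  = 1ℚ
x ^ℚ suc n = x * (x ^ℚ n)

-- "the aspect ratio max_e w(e) / min_e w(e) is at least 2^(n/a)" (for positive w):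
-- some pair of edges e₁, e₂ has w(e₁)^a ≥ 2^n · w(e₂)^a.
AspectRatioAtLeast2^[n/a] : ∀ {m} → Weight m → (n a : ℕ) → Set
AspectRatioAtLeast2^[n/a] {m} w n a =
  ∃[ u₁ ] ∃[ v₁ ] ∃[ u₂ ] ∃[ v₂ ] Σ (Edge m u₁ v₁) λ e₁ → Σ (Edge m u₂ v₂) λ e₂ →
    (((1ℚ + 1ℚ) ^ℚ n) * (w e₂ ^ℚ a)) ≤ℚ (w e₁ ^ℚ a)

{-# OPTIONS --safe #-}
-- Compare the path of 𝒫 from v_i^k with the detour v_i^k → v_i^{k'} → v_{i+1}^{k'}. Both end at
-- v_{i+1}^{k'} because C_{i+1} runs opposite to C_i, so two steps along C_{i+1} are one step along
-- C_i. Summing len(path) ≤ len(detour) over k, the cross edges cancel (k ↦ k' is a bijection), and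
-- so does one of the two copies of C_{i+1}, leaving 2 w(C_{i+1}) ≤ w(C_i). Hence
-- 2^{m-1} w(C_m) ≤ w(C_1): the heaviest edge of C_1 is 2^{m-1} ≥ 2^{n/6} times the lightest
-- edge of C_m once m ≥ 2.
module Submission where

open import Defs
open import Data.Nat as ℕ using (ℕ; zero; suc; s≤s; z≤n; _≤_; _<_; _*_)
open import Data.Product using (_×_; ∃-syntax; _,_)

open import Algebra.Bundles using (CommutativeRing; CommutativeSemiring)
open import Data.Bool using (true; false)
open import Data.Fin using (Fin; zero; suc)
open import Data.Fin.Permutation using (Permutation′; permutation)
import Data.Nat.Properties as ℕ
open import Data.Rational
  using (ℚ; 0ℚ; 1ℚ; _+_; -_; NonNegative; nonNegative)
  renaming (_*_ to _·_; _≤_ to _≤ℚ_; _<_ to _<ℚ_)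
import Data.Rational.Properties as Q
open import Data.Sum using (inj₁; inj₂)
open import Data.Vec.Functional using (Vector)
open import Function using (_∘_)
open import Relation.Binary.Bundles using (TotalPreorder)
import Relation.Binary.Construct.Flip.EqAndOrd as Flip
open import Relation.Binary.PropositionalEquality
open import Relation.Nullary.Decidable using (from-yes)

ℚ-commutativeSemiring : CommutativeSemiring _ _
ℚ-commutativeSemiring = CommutativeRing.commutativeSemiring Q.+-*-commutativeRing

open import Algebra.Properties.CommutativeSemiring.Exp ℚ-commutativeSemiring
  using (_^_; ^-assocʳ; ^-distrib-*)
open import Algebra.Properties.Semiring.Mult (CommutativeSemiring.semiring ℚ-commutativeSemiring)
  using (×-comm-*) renaming (_×_ to _×ℚ_)
open import Algebra.Properties.CommutativeMonoid.Sum Q.+-0-commutativeMonoid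
  using (sum; sum-syntax; ∑-distrib-+; sum-cong-≗; sum-permute; sum-replicate)
open import Algebra.Properties.Group Q.+-0-group using (\\-leftDividesʳ)

module _ {a ℓ₁ ℓ₂} (O : TotalPreorder a ℓ₁ ℓ₂) where
  open TotalPreorder O using (Carrier; _≲_; total) renaming (refl to ≲-refl; trans to ≲-trans)

  max-attained : ∀ {n} (f : Fin (suc n) → Carrier) → ∃[ k ] (∀ j → f j ≲ f k)
  max-attained {zero}  f = zero , λ { zero → ≲-refl }
  max-attained {suc n} f with max-attained (f ∘ suc)
  ... | k , f≲fk with total (f zero) (f (suc k))
  ...   | inj₁ f0≲fk = suc k , λ { zero → f0≲fk ; (suc j) → f≲fk j }
  ...   | inj₂ fk≲f0 = zero  , λ { zero → ≲-refl ; (suc j) → ≲-trans (f≲fk j) fk≲f0 }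

module _ {a ℓ₁ ℓ₂} (O : TotalPreorder a ℓ₁ ℓ₂) where
  open TotalPreorder O using (Carrier; _≲_)

  min-attained : ∀ {n} (f : Fin (suc n) → Carrier) → ∃[ k ] (∀ j → f k ≲ f j)
  min-attained = max-attained (Flip.totalPreorder O)

open Q.≤-Reasoning

+-cancelˡ-≤ : ∀ r {p q} → r + p ≤ℚ r + q → p ≤ℚ q
+-cancelˡ-≤ r {p} {q} r+p≤r+q = begin
  p             ≡⟨ \\-leftDividesʳ r p ⟨
  - r + (r + p) ≤⟨ Q.+-monoʳ-≤ (- r) r+p≤r+q ⟩
  - r + (r + q) ≡⟨ \\-leftDividesʳ r q ⟩
  q             ∎

×-monoʳ-< : ∀ n {p q} → p <ℚ q → suc n ×ℚ p <ℚ suc n ×ℚ q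
×-monoʳ-< zero    p<q = Q.+-mono-<-≤ p<q Q.≤-refl
×-monoʳ-< (suc n) p<q = Q.+-mono-< p<q (×-monoʳ-< n p<q)

×-cancelʳ-≤ : ∀ n {p q} → suc n ×ℚ p ≤ℚ suc n ×ℚ q → p ≤ℚ q
×-cancelʳ-≤ n np≤nq = Q.≮⇒≥ λ q<p → Q.<-irrefl refl (Q.<-≤-trans (×-monoʳ-< n q<p) np≤nq)

sum-mono-≤ : ∀ {n} {f g : Vector ℚ n} → (∀ i → f i ≤ℚ g i) → sum f ≤ℚ sum g
sum-mono-≤ {zero}  f≤g = Q.≤-refl
sum-mono-≤ {suc n} f≤g = Q.+-mono-≤ (f≤g zero) (sum-mono-≤ (f≤g ∘ suc))

*-nonNeg : ∀ {p q} → 0ℚ ≤ℚ p → 0ℚ ≤ℚ q → 0ℚ ≤ℚ p · q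
*-nonNeg {p} {q} 0≤p 0≤q =
  Q.nonNegative⁻¹ (p · q) {{Q.nonNeg*nonNeg⇒nonNeg p {{nonNegative 0≤p}} q {{nonNegative 0≤q}}}}

*-mono-≤-nonNeg : ∀ {p q r s} → 0ℚ ≤ℚ p → 0ℚ ≤ℚ r → p ≤ℚ q → r ≤ℚ s → p · r ≤ℚ q · s
*-mono-≤-nonNeg {p} {q} {r} {s} 0≤p 0≤r p≤q r≤s = begin
  p · r ≤⟨ Q.*-monoʳ-≤-nonNeg r {{nonNegative 0≤r}} p≤q ⟩
  q · r ≤⟨ Q.*-monoˡ-≤-nonNeg q {{nonNegative (Q.≤-trans 0≤p p≤q)}} r≤s ⟩
  q · s ∎

^-nonNeg : ∀ {p} n → 0ℚ ≤ℚ p → 0ℚ ≤ℚ p ^ n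
^-nonNeg zero    0≤p = Q.nonNegative⁻¹ 1ℚ
^-nonNeg (suc n) 0≤p = *-nonNeg 0≤p (^-nonNeg n 0≤p)

^-monoˡ-≤ : ∀ {p q} n → 0ℚ ≤ℚ p → p ≤ℚ q → p ^ n ≤ℚ q ^ n
^-monoˡ-≤ zero    0≤p p≤q = Q.≤-refl
^-monoˡ-≤ (suc n) 0≤p p≤q = *-mono-≤-nonNeg 0≤p (^-nonNeg n 0≤p) p≤q (^-monoˡ-≤ n 0≤p p≤q)

^-monoʳ-≤ : ∀ {p} → 1ℚ ≤ℚ p → ∀ {m n} → m ≤ n → p ^ m ≤ℚ p ^ n
^-monoʳ-≤ {p} 1≤p = mono
  where
  0≤p : 0ℚ ≤ℚ p
  0≤p = Q.≤-trans (Q.nonNegative⁻¹ 1ℚ) 1≤p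

  mono : ∀ {m n} → m ≤ n → p ^ m ≤ℚ p ^ n
  mono {n = zero}  z≤n       = Q.≤-refl
  mono {n = suc n} z≤n       = begin
    1ℚ         ≤⟨ mono {n = n} z≤n ⟩
    p ^ n      ≡⟨ Q.*-identityˡ (p ^ n) ⟨
    1ℚ · p ^ n ≤⟨ Q.*-monoʳ-≤-nonNeg (p ^ n) {{nonNegative (^-nonNeg n 0≤p)}} 1≤p ⟩
    p · p ^ n  ∎
  mono             (s≤s m≤n) = Q.*-monoˡ-≤-nonNeg p {{nonNegative 0≤p}} (mono m≤n)

^-ratio-≤ : ∀ {c p q k} a {n} → 1ℚ ≤ℚ c → 0ℚ ≤ℚ p → c ^ k · p ≤ℚ q → n ≤ k * a →
            c ^ n · p ^ a ≤ℚ q ^ a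
^-ratio-≤ {c} {p} {q} {k} a {n} 1≤c 0≤p cᵏp≤q n≤ka = begin
  c ^ n · p ^ a       ≤⟨ Q.*-monoʳ-≤-nonNeg (p ^ a) {{nonNegative (^-nonNeg a 0≤p)}} (^-monoʳ-≤ 1≤c n≤ka) ⟩
  c ^ (k * a) · p ^ a ≡⟨ cong (_· p ^ a) (^-assocʳ c k a) ⟨
  (c ^ k) ^ a · p ^ a ≡⟨ ^-distrib-* (c ^ k) p a ⟨
  (c ^ k · p) ^ a     ≤⟨ ^-monoˡ-≤ a (*-nonNeg (^-nonNeg k 0≤c) 0≤p) cᵏp≤q ⟩
  q ^ a               ∎
  where
  0≤c : 0ℚ ≤ℚ c
  0≤c = Q.≤-trans (Q.nonNegative⁻¹ 1ℚ) 1≤c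

^ℚ≗^ : ∀ p n → p ^ℚ n ≡ p ^ n
^ℚ≗^ p zero    = refl
^ℚ≗^ p (suc n) = cong (p ·_) (^ℚ≗^ p n)

2ℚ : ℚ
2ℚ = 1ℚ + 1ℚ

2ℚ·p≡p+p : ∀ p → 2ℚ · p ≡ p + p
2ℚ·p≡p+p p = trans (Q.*-distribʳ-+ p 1ℚ 1ℚ) (cong₂ _+_ (Q.*-identityˡ p) (Q.*-identityˡ p))

2ℚ^-nonNeg : ∀ j → NonNegative (2ℚ ^ j)
2ℚ^-nonNeg j = nonNegative (^-nonNeg j (Q.nonNegative⁻¹ 2ℚ))

step-suc-suc : ∀ i k → step (suc (suc i)) k ≡ step i k
step-suc-suc i k with isOdd i
... | true  = refl
... | false = refl

step-suc-step : ∀ i k → step (suc i) (step i k) ≡ k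
step-suc-step i k with isOdd i
step-suc-step i zero             | true  = refl
step-suc-step i (suc zero)       | true  = refl
step-suc-step i (suc (suc zero)) | true  = refl
step-suc-step i zero             | false = refl
step-suc-step i (suc zero)       | false = refl
step-suc-step i (suc (suc zero)) | false = refl

step-step-suc : ∀ i k → step i (step (suc i) k) ≡ k
step-step-suc i k = trans (sym (step-suc-suc i (step (suc i) k))) (step-suc-step (suc i) k)

step-suc-twice : ∀ i k → step (suc i) (step (suc i) k) ≡ step i k
step-suc-twice i k with isOdd i
step-suc-twice i zero             | true  = refl
step-suc-twice i (suc zero)       | true  = refl
step-suc-twice i (suc (suc zero)) | true  = refl
step-suc-twice i zero             | false = refl
step-suc-twice i (suc zero)       | false = refl
step-suc-twice i (suc (suc zero)) | false = refl

step-permutation : ℕ → Permutation′ 3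
step-permutation i = permutation (step i) (step (suc i)) (step-step-suc i) (step-suc-step i)

sum-step : ∀ i (f : Fin 3 → ℚ) → ∑[ k < 3 ] f (step i k) ≡ ∑[ k < 3 ] f k
sum-step i f = sym (sum-permute f (step-permutation i))

detour : ∀ {m} i k (1≤i : 1 ≤ i) (i<m : i < m) → Walk m (i , k) (suc i , step i k)
detour i k 1≤i i<m = cyc i k 1≤i (ℕ.<⇒≤ i<m) ∷ (cross i (step i k) 1≤i i<m ∷ [])

module _ {m : ℕ} (w : Weight m) where

  len-subst : ∀ {u v v′} (v≡v′ : v ≡ v′) (p : Walk m u v) →
              len w (subst (Walk m u) v≡v′ p) ≡ len w p
  len-subst refl p = refl

  cycleWeight : (i : ℕ) → 1 ≤ i → i ≤ m → ℚ
  cycleWeight i 1≤i i≤m = ∑[ k < 3 ] w (cyc i k 1≤i i≤m)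

  crossWeight : (i : ℕ) → 1 ≤ i → i < m → ℚ
  crossWeight i 1≤i i<m = ∑[ k < 3 ] w (cross i k 1≤i i<m)

  pathP≤detour : AllPShortest w → ∀ i k (1≤i : 1 ≤ i) (i<m : i < m) →
                 len w (pathP m i k 1≤i i<m) ≤ℚ len w (detour i k 1≤i i<m)
  pathP≤detour shortest i k 1≤i i<m = begin
    len w (pathP m i k 1≤i i<m)               ≤⟨ shortest i k 1≤i i<m (subst (Walk m (i , k)) same-end d) ⟩
    len w (subst (Walk m (i , k)) same-end d) ≡⟨ len-subst same-end d ⟩
    len w d                                   ∎
    where
    d = detour i k 1≤i i<m
    same-end : (suc i , step i k) ≡ (suc i , step (suc i) (step (suc i) k))
    same-end = cong (suc i ,_) (sym (step-suc-twice i k))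

  sum-len-pathP : ∀ i (1≤i : 1 ≤ i) (i<m : i < m) →
                  ∑[ k < 3 ] len w (pathP m i k 1≤i i<m)
                    ≡ crossWeight i 1≤i i<m + 2ℚ · cycleWeight (suc i) (s≤s z≤n) i<m
  sum-len-pathP i 1≤i i<m = begin-equality
    ∑[ k < 3 ] (X k + (C k + (C (step (suc i) k) + 0ℚ)))
      ≡⟨ sum-cong-≗ (λ k → cong (λ t → X k + (C k + t)) (Q.+-identityʳ (C (step (suc i) k)))) ⟩
    ∑[ k < 3 ] (X k + (C k + C (step (suc i) k)))
      ≡⟨ ∑-distrib-+ X (λ k → C k + C (step (suc i) k)) ⟩
    sum X + ∑[ k < 3 ] (C k + C (step (suc i) k))
      ≡⟨ cong (sum X +_) (∑-distrib-+ C (C ∘ step (suc i))) ⟩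
    sum X + (sum C + ∑[ k < 3 ] C (step (suc i) k))
      ≡⟨ cong (λ t → sum X + (sum C + t)) (sum-step (suc i) C) ⟩
    sum X + (sum C + sum C)
      ≡⟨ cong (sum X +_) (2ℚ·p≡p+p (sum C)) ⟨
    sum X + 2ℚ · sum C
      ∎
    where
    X C : Fin 3 → ℚ
    X k = w (cross i k 1≤i i<m)
    C k = w (cyc (suc i) k (s≤s z≤n) i<m)

  sum-len-detour : ∀ i (1≤i : 1 ≤ i) (i<m : i < m) →
                   ∑[ k < 3 ] len w (detour i k 1≤i i<m)
                     ≡ crossWeight i 1≤i i<m + cycleWeight i 1≤i (ℕ.<⇒≤ i<m)
  sum-len-detour i 1≤i i<m = begin-equality
    ∑[ k < 3 ] (C k + (X (step i k) + 0ℚ))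
      ≡⟨ sum-cong-≗ (λ k → cong (C k +_) (Q.+-identityʳ (X (step i k)))) ⟩
    ∑[ k < 3 ] (C k + X (step i k))
      ≡⟨ ∑-distrib-+ C (X ∘ step i) ⟩
    sum C + ∑[ k < 3 ] X (step i k)
      ≡⟨ cong (sum C +_) (sum-step i X) ⟩
    sum C + sum X
      ≡⟨ Q.+-comm (sum C) (sum X) ⟩
    sum X + sum C
      ∎
    where
    X C : Fin 3 → ℚ
    X k = w (cross i k 1≤i i<m)
    C k = w (cyc i k 1≤i (ℕ.<⇒≤ i<m))

  cycleWeight-halves : AllPShortest w → ∀ i (1≤i : 1 ≤ i) (i<m : i < m) →
                       2ℚ · cycleWeight (suc i) (s≤s z≤n) i<m ≤ℚ cycleWeight i 1≤i (ℕ.<⇒≤ i<m)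
  cycleWeight-halves shortest i 1≤i i<m = +-cancelˡ-≤ (crossWeight i 1≤i i<m) (begin
    crossWeight i 1≤i i<m + 2ℚ · cycleWeight (suc i) (s≤s z≤n) i<m
      ≡⟨ sum-len-pathP i 1≤i i<m ⟨
    ∑[ k < 3 ] len w (pathP m i k 1≤i i<m)
      ≤⟨ sum-mono-≤ (λ k → pathP≤detour shortest i k 1≤i i<m) ⟩
    ∑[ k < 3 ] len w (detour i k 1≤i i<m)
      ≡⟨ sum-len-detour i 1≤i i<m ⟩
    crossWeight i 1≤i i<m + cycleWeight i 1≤i (ℕ.<⇒≤ i<m)
      ∎)

  cycleWeight-decay : AllPShortest w → ∀ j (j<m : j < m) (0<m : 0 < m) →
                      2ℚ ^ j · cycleWeight (suc j) (s≤s z≤n) j<m ≤ℚ cycleWeight 1 (s≤s z≤n) 0<m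
  cycleWeight-decay shortest zero    0<m 0<m′ = begin
    1ℚ · cycleWeight 1 (s≤s z≤n) 0<m ≡⟨ Q.*-identityˡ _ ⟩
    cycleWeight 1 (s≤s z≤n) 0<m      ≡⟨ cong (cycleWeight 1 (s≤s z≤n)) (ℕ.≤-irrelevant 0<m 0<m′) ⟩
    cycleWeight 1 (s≤s z≤n) 0<m′     ∎
  cycleWeight-decay shortest (suc j) 1+j<m 0<m = begin
    2ℚ ^ suc j · S₂     ≡⟨ cong (_· S₂) (Q.*-comm 2ℚ (2ℚ ^ j)) ⟩
    (2ℚ ^ j · 2ℚ) · S₂  ≡⟨ Q.*-assoc (2ℚ ^ j) 2ℚ S₂ ⟩
    2ℚ ^ j · (2ℚ · S₂)  ≤⟨ Q.*-monoˡ-≤-nonNeg (2ℚ ^ j) {{2ℚ^-nonNeg j}}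
                             (cycleWeight-halves shortest (suc j) (s≤s z≤n) 1+j<m) ⟩
    2ℚ ^ j · S₁         ≤⟨ cycleWeight-decay shortest j (ℕ.<⇒≤ 1+j<m) 0<m ⟩
    cycleWeight 1 (s≤s z≤n) 0<m ∎
    where
    S₁ = cycleWeight (suc j) (s≤s z≤n) (ℕ.<⇒≤ 1+j<m)
    S₂ = cycleWeight (suc (suc j)) (s≤s z≤n) 1+j<m

  extremal-edge-ratio : AllPShortest w → ∀ j (j<m : j < m) (0<m : 0 < m) →
    ∃[ k₁ ] ∃[ k₂ ] 2ℚ ^ j · w (cyc (suc j) k₂ (s≤s z≤n) j<m) ≤ℚ w (cyc 1 k₁ (s≤s z≤n) 0<m)
  extremal-edge-ratio shortest j j<m 0<m
    with max-attained Q.≤-totalPreorder (λ k → w (cyc 1 k (s≤s z≤n) 0<m))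
       | min-attained Q.≤-totalPreorder (λ k → w (cyc (suc j) k (s≤s z≤n) j<m))
  ... | k₁ , ≤M | k₂ , μ≤ = k₁ , k₂ , ×-cancelʳ-≤ 2 (begin
    3 ×ℚ (2ℚ ^ j · μ)           ≡⟨ ×-comm-* 3 (2ℚ ^ j) μ ⟨
    2ℚ ^ j · (3 ×ℚ μ)           ≡⟨ cong (2ℚ ^ j ·_) (sum-replicate 3 {μ}) ⟨
    2ℚ ^ j · (∑[ k < 3 ] μ)     ≤⟨ Q.*-monoˡ-≤-nonNeg (2ℚ ^ j) {{2ℚ^-nonNeg j}} (sum-mono-≤ μ≤) ⟩
    2ℚ ^ j · cycleWeight (suc j) (s≤s z≤n) j<m
                                ≤⟨ cycleWeight-decay shortest j j<m 0<m ⟩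
    cycleWeight 1 (s≤s z≤n) 0<m ≤⟨ sum-mono-≤ ≤M ⟩
    ∑[ k < 3 ] M                ≡⟨ sum-replicate 3 {M} ⟩
    3 ×ℚ M                      ∎)
    where
    M = w (cyc 1 k₁ (s≤s z≤n) 0<m)
    μ = w (cyc (suc j) k₂ (s≤s z≤n) j<m)

exponent-bound : ∀ r → 3 * suc (suc r) ≤ suc r * 6
exponent-bound r = subst (_≤ suc r * 6) (sym (ℕ.*-distribˡ-+ 3 2 r)) (ℕ.+-monoʳ-≤ 6 3r≤6r)
  where
  3r≤6r : 3 * r ≤ r * 6
  3r≤6r = subst (_≤ r * 6) (ℕ.*-comm r 3) (ℕ.*-monoʳ-≤ r (from-yes (3 ℕ.≤? 6)))

AspectRatioAtLeast2^[n/a]-intro : ∀ {m} (w : Weight m) n a {u₁ v₁ u₂ v₂}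
                                  (e₁ : Edge m u₁ v₁) (e₂ : Edge m u₂ v₂) →
                                  2ℚ ^ n · w e₂ ^ a ≤ℚ w e₁ ^ a → AspectRatioAtLeast2^[n/a] w n a
AspectRatioAtLeast2^[n/a]-intro w n a e₁ e₂ 2ⁿw₂ᵃ≤w₁ᵃ = _ , _ , _ , _ , e₁ , e₂ ,
  subst₂ _≤ℚ_ (sym (cong₂ _·_ (^ℚ≗^ 2ℚ n) (^ℚ≗^ (w e₂) a))) (sym (^ℚ≗^ (w e₁) a)) 2ⁿw₂ᵃ≤w₁ᵃ

lemma2p2 : ∃[ a ] ∃[ N ] (1 ≤ a) × ((m : ℕ) → N ≤ 3 * m → (w : Weight m) → Positive w → AllPShortest w → AspectRatioAtLeast2^[n/a] w (3 * m) a)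
lemma2p2 = 6 , 6 , s≤s z≤n , aspect-ratio
  where
  aspect-ratio : (m : ℕ) → 6 ≤ 3 * m → (w : Weight m) → Positive w → AllPShortest w →
                 AspectRatioAtLeast2^[n/a] w (3 * m) 6
  aspect-ratio 0 ()
  aspect-ratio 1 (s≤s (s≤s (s≤s ())))
  aspect-ratio (suc (suc r)) _ w positive shortest =
    let k₁ , k₂ , ratio = extremal-edge-ratio w shortest (suc r) ℕ.≤-refl (s≤s z≤n)
        e₁ = cyc 1 k₁ (s≤s z≤n) (s≤s z≤n)
        e₂ = cyc (suc (suc r)) k₂ (s≤s z≤n) ℕ.≤-refl
    in AspectRatioAtLeast2^[n/a]-intro w (3 * suc (suc r)) 6 e₁ e₂
         (^-ratio-≤ {k = suc r} 6 (from-yes (1ℚ Q.≤? 2ℚ)) (Q.<⇒≤ (positive e₂)) ratio (exponent-bound r))
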